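{- Let $k\in\mathbb{N}$. For all vectors $\mathbf{a},\mathbf{b}\in\mathbb{N}^{k+1}$ and $x,y\in\mathbb{N}$, if $|\mathbf{b}|_\infty\le x$ and $(\mathbf{b},y)\leadsto_N(\mathbf{a},x)$, then $\Phi(\mathbf{a};x)\le\Phi(\mathbf{b};y)$.
   Context: The fast-growing functions are $F_0(x)=x+1$ and $F_{i+1}(x)=F_i^{x+1}(x)$. For $\mathbf{a}=(a_k,\dots,a_0)\in\mathbb{N}^{k+1}$, set $\Phi(\mathbf{a};x)=F_k^{a_k}(\cdots F_1^{a_1}(F_0^{a_0}(x))\cdots)$, and let $|\mathbf{b}|_\infty=\max_i b_i$. There are two kinds of rewrite rules on pairs $(\mathbf{a},x)$. - For $1\le j\le k$, rule $N1_j$ applies when $a_j\ge1$. It maps $(\mathbf{a},x)$ to $(\mathbf{a}',x)$ with $a'_j=a_j-1$, $a'_{j-1}=x+1$, and other components unchanged. - Rule $N2$ applies when $a_0\ge1$. It maps $(a_k,\dots,a_0;x)$ to $(a_k,\dots,a_1,a_0-1;x+1)$. Write $(\mathbf{b},y)\leadsto_N(\mathbf{a},x)$ if $(\mathbf{a},x)$ is obtained from $(\mathbf{b},y)$ by a finite sequence of applications of these rules. No properness restriction is imposed on these applications. -}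

module Defs where

open import Data.Nat using (ℕ; zero; suc; _+_; _∸_; _≤_)
open import Data.Fin using (Fin; zero; suc; inject₁; toℕ)
open import Data.Fin.Properties using (_≟_)
open import Data.Product using (_×_; _,_)
open import Relation.Nullary using (yes; no)
open import Relation.Binary.PropositionalEquality using (_≡_)

iter : ℕ → (ℕ → ℕ) → ℕ → ℕ
iter zero    f x = x
iter (suc n) f x = f (iter n f x)

F : ℕ → ℕ → ℕ
F zero    x = suc x
F (suc i) x = iter (suc x) (F i) x

-- vectors a = (a_k,...,a_0) ∈ ℕ^{k+1} are functions Fin (suc k) → ℕ,
-- with  a j  being the component a_j (index j = toℕ j).
Vecℕ : ℕ → Set
Vecℕ k = Fin (suc k) → ℕ

-- Φ(a;x) = F_k^{a_k}(... F_1^{a_1}(F_0^{a_0}(x)) ...)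
-- PhiUpTo a n x = F_{n-1}^{a_{n-1}}( ... F_0^{a_0}(x) ...) for n ≤ k+1
PhiUpTo : ∀ {m} → (Fin m → ℕ) → ℕ → ℕ
PhiUpTo {zero}  a x = x
PhiUpTo {suc m} a x = iter (a (Data.Fin.fromℕ m)) (F m) (PhiUpTo {m} (λ i → a (inject₁ i)) x)

Φ : ∀ {k} → Vecℕ k → ℕ → ℕ
Φ a x = PhiUpTo a x

‖_‖∞≤_ : ∀ {k} → Vecℕ k → ℕ → Set
‖ b ‖∞≤ x = ∀ i → b i ≤ x

update : ∀ {k} → Vecℕ k → Fin (suc k) → ℕ → Vecℕ k
update a j v i with i ≟ j
... | yes _ = v
... | no  _ = a i

data Step {k : ℕ} : Vecℕ k × ℕ → Vecℕ k × ℕ → Set where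
  -- N1_j for j = suc i (1 ≤ j ≤ k), with j-1 = inject₁ i
  N1 : ∀ (a : Vecℕ k) x (i : Fin k) → 1 ≤ a (suc i) →
       Step (a , x)
            (update (update a (suc i) (a (suc i) ∸ 1)) (inject₁ i) (suc x) , x)
  N2 : ∀ (a : Vecℕ k) x → 1 ≤ a zero →
       Step (a , x) (update a zero (a zero ∸ 1) , suc x)

data _⇝N_ {k : ℕ} : Vecℕ k × ℕ → Vecℕ k × ℕ → Set where
  done : ∀ {p} → p ⇝N p
  step : ∀ {p q r} → Step p q → q ⇝N r → p ⇝N r

module Submission where

open import Defs
open import Data.Nat using (ℕ; zero; suc; _≤_; _∸_; z≤n; s≤s; >-nonZero)
open import Data.Nat.Properties using (≤-refl; ≤-reflexive; ≤-trans; n≤1+n; suc-pred; module ≤-Reasoning)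
open import Data.Fin using (Fin; zero; suc; inject₁; fromℕ)
open import Data.Fin.Properties using (_≟_; fromℕ≢inject₁; inject₁-injective; suc-injective)
open import Data.Fin.Relation.Unary.Top using (view; ‵fromℕ; ‵inject₁)
open import Data.Vec.Functional using (init; last)
open import Data.Product using (_×_; _,_; uncurry)
open import Data.Empty using (⊥-elim)
open import Function using (_∘_)
open import Relation.Binary.Core using (_Preserves_⟶_)
open import Relation.Nullary using (yes; no)
open import Relation.Binary.PropositionalEquality using (_≡_; _≢_; refl; sym; trans; cong; cong₂)

-- Every rewrite step leaves Φ unchanged or decreases it.  N2 moves one F₀
-- from the vector into the argument.  N1_j trades one F_j for x+1 copies of
-- F_{j-1}; since F_j(u) = F_{j-1}^{u+1}(u) and the argument u reached at level
-- j-1 is at least x, this cannot increase the value.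

Inflationary : (ℕ → ℕ) → Set
Inflationary f = ∀ x → x ≤ f x

iter-comm : ∀ n f x → iter n f (f x) ≡ f (iter n f x)
iter-comm zero    f x = refl
iter-comm (suc n) f x = cong f (iter-comm n f x)

iter-monoʳ : ∀ {f} → f Preserves _≤_ ⟶ _≤_ → ∀ n → iter n f Preserves _≤_ ⟶ _≤_
iter-monoʳ mono zero    x≤y = x≤y
iter-monoʳ mono (suc n) x≤y = mono (iter-monoʳ mono n x≤y)

iter-inflationary : ∀ {f} → Inflationary f → ∀ n → Inflationary (iter n f)
iter-inflationary infl zero    x = ≤-refl
iter-inflationary infl (suc n) x = ≤-trans (iter-inflationary infl n x) (infl _)

iter-monoˡ : ∀ {f} → f Preserves _≤_ ⟶ _≤_ → Inflationary f →
             ∀ {m n} x → m ≤ n → iter m f x ≤ iter n f x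
iter-monoˡ mono infl {n = n} x z≤n     = iter-inflationary infl n x
iter-monoˡ mono infl         x (s≤s p) = mono (iter-monoˡ mono infl x p)

F-inflationary : ∀ i → Inflationary (F i)
F-inflationary zero    x = n≤1+n x
F-inflationary (suc i) x = iter-inflationary (F-inflationary i) (suc x) x

F-mono : ∀ i → F i Preserves _≤_ ⟶ _≤_
F-mono zero    x≤y = s≤s x≤y
F-mono (suc i) {x} {y} x≤y =
  ≤-trans (iter-monoˡ (F-mono i) (F-inflationary i) x (s≤s x≤y))
          (iter-monoʳ (F-mono i) (suc y) x≤y)

F-suc-dominates : ∀ i {x w u} → x ≤ u → w ≤ u → iter (suc x) (F i) w ≤ F (suc i) u
F-suc-dominates i {u = u} x≤u w≤u =
  ≤-trans (iter-monoˡ (F-mono i) (F-inflationary i) _ (s≤s x≤u))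
          (iter-monoʳ (F-mono i) (suc u) w≤u)

iter-F-trade : ∀ i n c {x w} → x ≤ w →
  iter n (F (suc i)) (iter (suc x) (F i) w) ≤ iter (suc n) (F (suc i)) (iter c (F i) w)
iter-F-trade i n c {x} {w} x≤w = begin
  iter n (F (suc i)) (iter (suc x) (F i) w)
    ≤⟨ iter-monoʳ (F-mono (suc i)) n (F-suc-dominates i x≤u w≤u) ⟩
  iter n (F (suc i)) (F (suc i) u)          ≡⟨ iter-comm n (F (suc i)) u ⟩
  iter (suc n) (F (suc i)) u                ∎
  where
  open ≤-Reasoning
  u = iter c (F i) w
  w≤u = iter-inflationary (F-inflationary i) c w
  x≤u = ≤-trans x≤w w≤u

PhiUpTo-inflationary : ∀ {m} (a : Fin m → ℕ) → Inflationary (PhiUpTo a)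
PhiUpTo-inflationary {zero}  a x = ≤-refl
PhiUpTo-inflationary {suc m} a x =
  ≤-trans (PhiUpTo-inflationary (init a) x) (iter-inflationary (F-inflationary m) (last a) _)

PhiUpTo-cong : ∀ {m} {a a' : Fin m → ℕ} → (∀ i → a' i ≡ a i) → ∀ x → PhiUpTo a' x ≡ PhiUpTo a x
PhiUpTo-cong {zero}  a'≗a x = refl
PhiUpTo-cong {suc m} a'≗a x =
  cong₂ (λ n z → iter n (F m) z) (a'≗a (fromℕ m)) (PhiUpTo-cong (a'≗a ∘ inject₁) x)

PhiUpTo-mono-init : ∀ {m} {a a' : Fin (suc m) → ℕ} {x x'} → last a' ≡ last a →
  PhiUpTo (init a') x' ≤ PhiUpTo (init a) x → PhiUpTo a' x' ≤ PhiUpTo a x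
PhiUpTo-mono-init {m} {a} {a'} eq p rewrite eq = iter-monoʳ (F-mono m) (last a) p

PhiUpTo-N2 : ∀ {m} {a a' : Fin (suc m) → ℕ} → suc (a' zero) ≡ a zero →
  (∀ l → a' (suc l) ≡ a (suc l)) → ∀ x → PhiUpTo a' (suc x) ≡ PhiUpTo a x
PhiUpTo-N2 {zero} {a' = a'} a'₀ rest x =
  trans (iter-comm (a' zero) (F 0) x) (cong (λ n → iter n (F 0) x) a'₀)
PhiUpTo-N2 {suc m} {a} {a'} a'₀ rest x =
  cong₂ (λ n z → iter n (F (suc m)) z) (rest (fromℕ m))
        (PhiUpTo-N2 {a = init a} {init a'} a'₀ (rest ∘ inject₁) x)

PhiUpTo-N1 : ∀ {m} (j : Fin m) {a a' : Fin (suc m) → ℕ} {x} →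
  suc (a' (suc j)) ≡ a (suc j) → a' (inject₁ j) ≡ suc x →
  (∀ l → l ≢ suc j → l ≢ inject₁ j → a' l ≡ a l) → PhiUpTo a' x ≤ PhiUpTo a x
PhiUpTo-N1 {suc m} j {a} {a'} {x} a'ⱼ a'ⱼ₋₁ rest with view j
... | ‵fromℕ = begin
  PhiUpTo a' x                        ≡⟨ cong₂ (λ t z → iter (last a') (F (suc m)) (iter t (F m) z))
                                               a'ⱼ₋₁ (PhiUpTo-cong below x) ⟩
  iter (last a') (F (suc m)) (iter (suc x) (F m) w)
                                      ≤⟨ iter-F-trade m (last a') (a (inject₁ (fromℕ m)))
                                                      (PhiUpTo-inflationary (init (init a)) x) ⟩
  iter (suc (last a')) (F (suc m)) u  ≡⟨ cong (λ t → iter t (F (suc m)) u) a'ⱼ ⟩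
  PhiUpTo a x                         ∎
  where
  open ≤-Reasoning
  w = PhiUpTo (init (init a)) x
  u = iter (a (inject₁ (fromℕ m))) (F m) w
  below : ∀ l → init (init a') l ≡ init (init a) l
  below l = rest _ (fromℕ≢inject₁ ∘ sym) (fromℕ≢inject₁ ∘ sym ∘ inject₁-injective)
... | ‵inject₁ i =
  PhiUpTo-mono-init {a = a} {a'}
    (rest _ (fromℕ≢inject₁ {i = suc i}) (fromℕ≢inject₁ {i = inject₁ i}))
    (PhiUpTo-N1 i {init a} {init a'} a'ⱼ a'ⱼ₋₁ λ l l≢j l≢j-1 →
       rest (inject₁ l) (l≢j ∘ inject₁-injective) (l≢j-1 ∘ inject₁-injective))

update-same : ∀ {k} (a : Vecℕ k) j v → update a j v j ≡ v
update-same a j v with j ≟ j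
... | yes _   = refl
... | no j≢j = ⊥-elim (j≢j refl)

update-other : ∀ {k} (a : Vecℕ k) j v {i} → i ≢ j → update a j v i ≡ a i
update-other a j v {i} i≢j with i ≟ j
... | yes i≡j = ⊥-elim (i≢j i≡j)
... | no _    = refl

suc≢inject₁ : ∀ {k} (i : Fin k) → suc i ≢ inject₁ i
suc≢inject₁ zero    ()
suc≢inject₁ (suc i) eq = suc≢inject₁ i (suc-injective eq)

suc-∸1 : ∀ {n} → 1 ≤ n → suc (n ∸ 1) ≡ n
suc-∸1 1≤n = suc-pred _ {{>-nonZero 1≤n}}

Step-antitone : ∀ {k} {p q : Vecℕ k × ℕ} → Step p q → uncurry Φ q ≤ uncurry Φ p
Step-antitone (N1 a x i 1≤aᵢ₊₁) = PhiUpTo-N1 i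
  (trans (cong suc (trans (update-other _ _ _ (suc≢inject₁ i)) (update-same a (suc i) _)))
         (suc-∸1 1≤aᵢ₊₁))
  (update-same _ (inject₁ i) (suc x))
  (λ l l≢j l≢j-1 → trans (update-other _ _ _ l≢j-1) (update-other a _ _ l≢j))
Step-antitone (N2 a x 1≤a₀) = ≤-reflexive (PhiUpTo-N2 {a = a} {update a zero (a zero ∸ 1)}
  (trans (cong suc (update-same a zero _)) (suc-∸1 1≤a₀))
  (λ l → update-other a zero (a zero ∸ 1) λ ())
  x)

⇝N-antitone : ∀ {k} {p q : Vecℕ k × ℕ} → p ⇝N q → uncurry Φ q ≤ uncurry Φ p
⇝N-antitone done          = ≤-refl
⇝N-antitone (step s rest) = ≤-trans (⇝N-antitone rest) (Step-antitone s)

lemma11 : (k : ℕ) (a b : Vecℕ k) (x y : ℕ) →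
    ‖ b ‖∞≤ x → (b , y) ⇝N (a , x) → Φ a x ≤ Φ b y
lemma11 k a b x y _ = ⇝N-antitone
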